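{- Let $n \ge 1$ be an integer and let $f = 1 + f_1 x + f_2 x^2 + \cdots \in R$. If $A$ and $B$ are positive integers such that $\mu_n \mid AB$ and $\mu_n \mid A^2$, and $B \mid f_1$, then $f(Ax) \in \mathcal{P}_n$.
   Context: $R := 1 + x\mathbb{Z}[[x]]$ is the set of formal power series with integer coefficients and constant term $1$. For an integer $n \ge 1$, $\mathcal{P}_n := \{ g^n \mid g \in R\}$, and $\mu_n := n \prod_{p \mid n} p$ (product over the primes dividing $n$). $f(Ax)$ denotes the series $\sum_k f_k A^k x^k$. -}

module Defs where

open import Data.Nat as ℕ using (ℕ; zero; suc)
open import Data.Nat.Divisibility as ℕD using ()
open import Data.Nat.Primality using (Prime; prime?)
open import Data.Integer as ℤ using (ℤ; +_)
open import Data.List using (List; []; _∷_; filter; upTo)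
open import Data.Nat.ListAction using (product)
open import Data.Product using (_×_; Σ)
open import Relation.Binary.PropositionalEquality using (_≡_)
open import Relation.Nullary.Decidable using (_×-dec_)

Series : Set
Series = ℕ → ℤ

sumTo : ℕ → (ℕ → ℤ) → ℤ
sumTo zero    g = g 0
sumTo (suc k) g = sumTo k g ℤ.+ g (suc k)

_⊛_ : Series → Series → Series
(f ⊛ g) k = sumTo k (λ i → f i ℤ.* g (k ℕ.∸ i))

one : Series
one zero    = + 1
one (suc _) = + 0

_^ˢ_ : Series → ℕ → Series
g ^ˢ zero  = one
g ^ˢ suc n = g ⊛ (g ^ˢ n)

InR : Series → Set
InR f = f 0 ≡ + 1

_≈ˢ_ : Series → Series → Set
f ≈ˢ g = ∀ k → f k ≡ g k

InP : ℕ → Series → Set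
InP n f = Σ Series (λ g → InR g × (g ^ˢ n) ≈ˢ f)

scale : ℤ → Series → Series
scale A f k = f k ℤ.* (A ℤ.^ k)

-- the primes dividing n (as a list; primes are ≤ n for n ≥ 1)
primeDivisors : ℕ → List ℕ
primeDivisors n = filter (λ p → prime? p ×-dec (p ℕD.∣? n)) (upTo (suc n))

μ : ℕ → ℕ
μ n = n ℕ.* product (primeDivisors n)

-- Write μ n = n · r with r the radical of n, and say u ≡ 1 (mod t) when u 0 = 1 and t divides
-- every coefficient of positive degree.  For such u the coefficients of positive degree satisfy
-- (u ^ d) k ≡ d · u k (mod t²), so u ^ d ≡ 1 (mod d t) whenever d ∣ t; applying this prime by
-- prime along the factorisation of n turns u ≡ 1 (mod r) into u ^ n ≡ 1 (mod μ n).
-- Conversely every T ≡ 1 (mod μ n) is an n-th power: build the root g ≡ 1 (mod r) degree by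
-- degree.  Adding c xᵏ⁺¹ to g leaves the coefficients of g ^ n below k + 1 alone and adds n c to
-- the one of degree k + 1, and the remaining gap there is a multiple of n r, so a multiple c of
-- r closes it.  Finally f (A x) ≡ 1 (mod μ n), since μ n ∣ A B ∣ A f₁ and μ n ∣ A² ∣ Aᵏ fₖ for k ≥ 2.
module Submission where

open import Defs
open import Data.Nat as ℕ using (ℕ)
open import Data.Integer as ℤ using (ℤ; +_)
open import Data.Integer.Divisibility as ℤD using ()

open import Data.Nat using (zero; suc; _≤_; _<_; z≤n; s≤s; _≟_; _≤′_; ≤′-refl; ≤′-step; NonZero; >-nonZero)
import Data.Nat.Properties as ℕₚ
import Data.Nat.Divisibility as ℕD
open import Data.Nat.Primality using (Prime; prime?)
open import Data.Nat.Primality.Factorisation using (factorise; PrimeFactorisation)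
open import Data.Nat.ListAction using (product)
open import Data.Nat.ListAction.Properties using (∈⇒∣product)
open import Data.Integer using (_+_; _-_; _*_; _^_)
import Data.Integer.Properties as ℤₚ
open import Data.Integer.Divisibility.Signed
  using (_∣_; divides; ∣-refl; ∣-trans; ∣ᵤ⇒∣; ∣m∣n⇒∣m+n; ∣m∣n⇒∣m-n; ∣m+n∣n⇒∣m; ∣m⇒∣-m;
         ∣n⇒∣m*n; ∣m⇒∣m*n; *-monoʳ-∣; *-monoˡ-∣)
open import Data.Integer.Tactic.RingSolver using (solve-∀)
open import Data.List using ([]; _∷_)
open import Data.List.Membership.Propositional using (_∈_)
open import Data.List.Membership.Propositional.Properties using (∈-filter⁺; ∈-upTo⁺)
open import Data.List.Relation.Unary.Any using (here; there)
import Data.List.Relation.Unary.All as All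
open import Data.Product using (_,_)
open import Data.Sum using (inj₁; inj₂)
open import Function using (_∘_)
open import Relation.Nullary using (yes; no; ¬_; contradiction)
open import Relation.Nullary.Decidable using (_×-dec_)
open import Relation.Binary.PropositionalEquality

private
  variable
    k : ℕ
    t : ℤ
    u u′ v v′ : Series

sumTo-cong : ∀ k {g h : ℕ → ℤ} → (∀ i → i ≤ k → g i ≡ h i) → sumTo k g ≡ sumTo k h
sumTo-cong zero    g≡h = g≡h 0 z≤n
sumTo-cong (suc k) g≡h =
  cong₂ _+_ (sumTo-cong k (λ i i≤k → g≡h i (ℕₚ.m≤n⇒m≤1+n i≤k))) (g≡h (suc k) ℕₚ.≤-refl)

sumTo-zero : ∀ k {g : ℕ → ℤ} → (∀ i → g i ≡ + 0) → sumTo k g ≡ + 0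
sumTo-zero zero    g≡0 = g≡0 0
sumTo-zero (suc k) g≡0 = cong₂ _+_ (sumTo-zero k g≡0) (g≡0 (suc k))

sumTo-+ : ∀ k g h → sumTo k (λ i → g i + h i) ≡ sumTo k g + sumTo k h
sumTo-+ zero    g h = refl
sumTo-+ (suc k) g h =
  trans (cong (_+ (g (suc k) + h (suc k))) (sumTo-+ k g h))
        (interchange (sumTo k g) (sumTo k h) (g (suc k)) (h (suc k)))
  where
  interchange : ∀ a b c d → (a + b) + (c + d) ≡ (a + c) + (b + d)
  interchange = solve-∀

sumTo-*ˡ : ∀ k c g → sumTo k (λ i → c * g i) ≡ c * sumTo k g
sumTo-*ˡ zero    c g = refl
sumTo-*ˡ (suc k) c g =
  trans (cong (_+ c * g (suc k)) (sumTo-*ˡ k c g)) (sym (ℤₚ.*-distribˡ-+ c (sumTo k g) (g (suc k))))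

sumTo-*ʳ : ∀ k g c → sumTo k (λ i → g i * c) ≡ sumTo k g * c
sumTo-*ʳ zero    g c = refl
sumTo-*ʳ (suc k) g c =
  trans (cong (_+ g (suc k) * c) (sumTo-*ʳ k g c)) (sym (ℤₚ.*-distribʳ-+ c (sumTo k g) (g (suc k))))

sumTo-suc : ∀ k g → sumTo (suc k) g ≡ g 0 + sumTo k (g ∘ suc)
sumTo-suc zero    g = refl
sumTo-suc (suc k) g =
  trans (cong (_+ g (suc (suc k))) (sumTo-suc k g)) (ℤₚ.+-assoc (g 0) _ _)

sumTo-∣ : ∀ k {d} g → (∀ i → i ≤ k → d ∣ g i) → d ∣ sumTo k g
sumTo-∣ zero    g d∣g = d∣g 0 z≤n
sumTo-∣ (suc k) g d∣g =
  ∣m∣n⇒∣m+n (sumTo-∣ k g (λ i i≤k → d∣g i (ℕₚ.m≤n⇒m≤1+n i≤k))) (d∣g (suc k) ℕₚ.≤-refl)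

sumTo-triangle : ∀ k (F : ℕ → ℕ → ℤ) →
  sumTo k (λ i → sumTo i (F i)) ≡ sumTo k (λ j → sumTo (k ℕ.∸ j) (λ l → F (j ℕ.+ l) j))
sumTo-triangle zero    F = refl
sumTo-triangle (suc k) F = sym (begin
  sumTo k (λ j → column (suc k) j) + sumTo (k ℕ.∸ k) (λ l → F (suc k ℕ.+ l) (suc k))
    ≡⟨ cong₂ _+_ (sumTo-cong k column-suc) diagonal-term ⟩
  sumTo k (λ j → column k j + F (suc k) j) + F (suc k) (suc k)
    ≡⟨ cong (_+ F (suc k) (suc k)) (sumTo-+ k _ _) ⟩
  sumTo k (column k) + sumTo k (F (suc k)) + F (suc k) (suc k)
    ≡⟨ ℤₚ.+-assoc (sumTo k (column k)) _ _ ⟩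
  sumTo k (column k) + sumTo (suc k) (F (suc k))
    ≡⟨ cong (_+ sumTo (suc k) (F (suc k))) (sym (sumTo-triangle k F)) ⟩
  sumTo k (λ i → sumTo i (F i)) + sumTo (suc k) (F (suc k)) ∎)
  where
  open ≡-Reasoning
  column : ℕ → ℕ → ℤ
  column m j = sumTo (m ℕ.∸ j) (λ l → F (j ℕ.+ l) j)
  column-suc : ∀ j → j ≤ k → column (suc k) j ≡ column k j + F (suc k) j
  column-suc j j≤k rewrite ℕₚ.+-∸-assoc 1 j≤k =
    cong (λ m → column k j + F m j) (trans (ℕₚ.+-suc j (k ℕ.∸ j)) (cong suc (ℕₚ.m+[n∸m]≡n j≤k)))
  diagonal-term : sumTo (k ℕ.∸ k) (λ l → F (suc k ℕ.+ l) (suc k)) ≡ F (suc k) (suc k)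
  diagonal-term rewrite ℕₚ.n∸n≡0 k = cong (λ m → F m (suc k)) (ℕₚ.+-identityʳ (suc k))

infix 4 _≈[_]_

_≈[_]_ : Series → ℕ → Series → Set
u ≈[ k ] v = ∀ i → i ≤ k → u i ≡ v i

≈[]-extend : u ≈[ k ] v → u (suc k) ≡ v (suc k) → u ≈[ suc k ] v
≈[]-extend u≈v eq i i≤1+k with ℕₚ.m≤n⇒m<n∨m≡n i≤1+k
... | inj₁ (s≤s i≤k) = u≈v i i≤k
... | inj₂ refl      = eq

⊛-cong-≈[] : u ≈[ k ] u′ → v ≈[ k ] v′ → (u ⊛ v) ≈[ k ] (u′ ⊛ v′)
⊛-cong-≈[] u≈u′ v≈v′ j j≤k = sumTo-cong j (λ i i≤j →
  cong₂ _*_ (u≈u′ i (ℕₚ.≤-trans i≤j j≤k)) (v≈v′ (j ℕ.∸ i) (ℕₚ.≤-trans (ℕₚ.m∸n≤m j i) j≤k)))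

^ˢ-cong-≈[] : ∀ n → u ≈[ k ] v → (u ^ˢ n) ≈[ k ] (v ^ˢ n)
^ˢ-cong-≈[] zero    u≈v i _ = refl
^ˢ-cong-≈[] (suc n) u≈v     = ⊛-cong-≈[] u≈v (^ˢ-cong-≈[] n u≈v)

⊛-cong : u ≈ˢ u′ → v ≈ˢ v′ → (u ⊛ v) ≈ˢ (u′ ⊛ v′)
⊛-cong u≈u′ v≈v′ k = ⊛-cong-≈[] (λ i _ → u≈u′ i) (λ i _ → v≈v′ i) k ℕₚ.≤-refl

⊛-assoc : ∀ f g h → ((f ⊛ g) ⊛ h) ≈ˢ (f ⊛ (g ⊛ h))
⊛-assoc f g h k = begin
  sumTo k (λ i → sumTo i (λ j → f j * g (i ℕ.∸ j)) * h (k ℕ.∸ i))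
    ≡⟨ sumTo-cong k (λ i _ → sym (sumTo-*ʳ i _ _)) ⟩
  sumTo k (λ i → sumTo i (λ j → f j * g (i ℕ.∸ j) * h (k ℕ.∸ i)))
    ≡⟨ sumTo-triangle k (λ i j → f j * g (i ℕ.∸ j) * h (k ℕ.∸ i)) ⟩
  sumTo k (λ j → sumTo (k ℕ.∸ j) (λ l → f j * g (j ℕ.+ l ℕ.∸ j) * h (k ℕ.∸ (j ℕ.+ l))))
    ≡⟨ sumTo-cong k (λ j _ → sumTo-cong (k ℕ.∸ j) (λ l _ →
         trans (cong₂ (λ a b → f j * g a * h b) (ℕₚ.m+n∸m≡n j l) (sym (ℕₚ.∸-+-assoc k j l)))
               (ℤₚ.*-assoc (f j) _ _))) ⟩
  sumTo k (λ j → sumTo (k ℕ.∸ j) (λ l → f j * (g l * h (k ℕ.∸ j ℕ.∸ l))))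
    ≡⟨ sumTo-cong k (λ j _ → sumTo-*ˡ (k ℕ.∸ j) (f j) _) ⟩
  sumTo k (λ j → f j * sumTo (k ℕ.∸ j) (λ l → g l * h (k ℕ.∸ j ℕ.∸ l))) ∎
  where open ≡-Reasoning

-- The terms of (u ⊛ v) (suc k) involving neither u 0 nor v 0.
interior : Series → Series → ℕ → ℤ
interior u v zero    = + 0
interior u v (suc m) = sumTo m (λ i → u (suc i) * v (suc (m ℕ.∸ i)))

⊛-suc : ∀ u v k → (u ⊛ v) (suc k) ≡ u 0 * v (suc k) + interior u v k + u (suc k) * v 0
⊛-suc u v zero    = cong (_+ u 1 * v 0) (sym (ℤₚ.+-identityʳ (u 0 * v 1)))
⊛-suc u v (suc m) = begin
  (u ⊛ v) (suc (suc m))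
    ≡⟨ sumTo-suc (suc m) _ ⟩
  u 0 * v (suc (suc m)) + (sumTo m (λ i → u (suc i) * v (suc m ℕ.∸ i)) + u (suc (suc m)) * v (m ℕ.∸ m))
    ≡⟨ cong₂ (λ s w → u 0 * v (suc (suc m)) + (s + u (suc (suc m)) * v w))
             (sumTo-cong m (λ i i≤m → cong (λ j → u (suc i) * v j) (ℕₚ.+-∸-assoc 1 i≤m)))
             (ℕₚ.n∸n≡0 m) ⟩
  u 0 * v (suc (suc m)) + (interior u v (suc m) + u (suc (suc m)) * v 0)
    ≡⟨ sym (ℤₚ.+-assoc (u 0 * v (suc (suc m))) (interior u v (suc m)) _) ⟩
  u 0 * v (suc (suc m)) + interior u v (suc m) + u (suc (suc m)) * v 0 ∎
  where open ≡-Reasoning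

interior-cong : u ≈[ k ] u′ → v ≈[ k ] v′ → interior u v k ≡ interior u′ v′ k
interior-cong {k = zero}  u≈u′ v≈v′ = refl
interior-cong {k = suc m} u≈u′ v≈v′ = sumTo-cong m (λ i i≤m →
  cong₂ _*_ (u≈u′ (suc i) (s≤s i≤m)) (v≈v′ (suc (m ℕ.∸ i)) (s≤s (ℕₚ.m∸n≤m m i))))

interior-oneˡ : ∀ v k → interior one v k ≡ + 0
interior-oneˡ v zero    = refl
interior-oneˡ v (suc m) = sumTo-zero m (λ _ → refl)

interior-oneʳ : ∀ u k → interior u one k ≡ + 0
interior-oneʳ u zero    = refl
interior-oneʳ u (suc m) = sumTo-zero m (λ i → ℤₚ.*-zeroʳ (u (suc i)))

⊛-identityˡ : ∀ v → (one ⊛ v) ≈ˢ v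
⊛-identityˡ v zero    = ℤₚ.*-identityˡ (v 0)
⊛-identityˡ v (suc k) =
  trans (⊛-suc one v k)
        (trans (cong (λ s → + 1 * v (suc k) + s + + 0) (interior-oneˡ v k)) (drop-zeros (v (suc k))))
  where
  drop-zeros : ∀ a → + 1 * a + + 0 + + 0 ≡ a
  drop-zeros = solve-∀

⊛-identityʳ : ∀ u → (u ⊛ one) ≈ˢ u
⊛-identityʳ u zero    = ℤₚ.*-identityʳ (u 0)
⊛-identityʳ u (suc k) =
  trans (⊛-suc u one k)
        (trans (cong (λ s → u 0 * + 0 + s + u (suc k) * + 1) (interior-oneʳ u k)) (drop-zeros (u (suc k)) (u 0)))
  where
  drop-zeros : ∀ a b → b * + 0 + + 0 + a * + 1 ≡ a
  drop-zeros = solve-∀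

^ˢ-distribˡ-+-⊛ : ∀ u a b → (u ^ˢ (a ℕ.+ b)) ≈ˢ ((u ^ˢ a) ⊛ (u ^ˢ b))
^ˢ-distribˡ-+-⊛ u zero    b k = sym (⊛-identityˡ (u ^ˢ b) k)
^ˢ-distribˡ-+-⊛ u (suc a) b k =
  trans (⊛-cong {u = u} (λ _ → refl) (^ˢ-distribˡ-+-⊛ u a b) k) (sym (⊛-assoc u (u ^ˢ a) (u ^ˢ b) k))

^ˢ-*-assoc : ∀ u a b → ((u ^ˢ a) ^ˢ b) ≈ˢ (u ^ˢ (a ℕ.* b))
^ˢ-*-assoc u a zero    k = cong (λ m → (u ^ˢ m) k) (sym (ℕₚ.*-zeroʳ a))
^ˢ-*-assoc u a (suc b) k = begin
  ((u ^ˢ a) ⊛ ((u ^ˢ a) ^ˢ b)) k  ≡⟨ ⊛-cong {u = u ^ˢ a} (λ _ → refl) (^ˢ-*-assoc u a b) k ⟩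
  ((u ^ˢ a) ⊛ (u ^ˢ (a ℕ.* b))) k ≡⟨ sym (^ˢ-distribˡ-+-⊛ u a (a ℕ.* b) k) ⟩
  (u ^ˢ (a ℕ.+ a ℕ.* b)) k        ≡⟨ cong (λ m → (u ^ˢ m) k) (sym (ℕₚ.*-suc a b)) ⟩
  (u ^ˢ (a ℕ.* suc b)) k ∎
  where open ≡-Reasoning

InR-⊛ : ∀ u v → InR u → InR v → InR (u ⊛ v)
InR-⊛ u v = cong₂ _*_

InR-^ˢ : ∀ u n → InR u → InR (u ^ˢ n)
InR-^ˢ u zero    u∈R = refl
InR-^ˢ u (suc n) u∈R = InR-⊛ u (u ^ˢ n) u∈R (InR-^ˢ u n u∈R)

⊛-suc-InR : ∀ u v → InR u → InR v → ∀ k → (u ⊛ v) (suc k) ≡ v (suc k) + interior u v k + u (suc k)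
⊛-suc-InR u v u∈R v∈R k = begin
  (u ⊛ v) (suc k)
    ≡⟨ ⊛-suc u v k ⟩
  u 0 * v (suc k) + interior u v k + u (suc k) * v 0
    ≡⟨ cong₂ (λ a b → a * v (suc k) + interior u v k + u (suc k) * b) u∈R v∈R ⟩
  + 1 * v (suc k) + interior u v k + u (suc k) * + 1
    ≡⟨ drop-units (u (suc k)) (v (suc k)) (interior u v k) ⟩
  v (suc k) + interior u v k + u (suc k) ∎
  where
  open ≡-Reasoning
  drop-units : ∀ a b c → + 1 * b + c + a * + 1 ≡ b + c + a
  drop-units = solve-∀

-- Series congruent to 1 modulo t

record InR[_] (t : ℤ) (u : Series) : Set where
  field
    ∈R     : InR u
    ∣coeff : ∀ k → t ∣ u (suc k)

open InR[_]

InR[]-resp-≈ˢ : u ≈ˢ v → InR[ t ] u → InR[ t ] v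
InR[]-resp-≈ˢ {t = t} u≈v u∈ = record
  { ∈R     = trans (sym (u≈v 0)) (∈R u∈)
  ; ∣coeff = λ k → subst (t ∣_) (u≈v (suc k)) (∣coeff u∈ k)
  }

InR[]-one : InR[ t ] one
InR[]-one = record { ∈R = refl ; ∣coeff = λ _ → divides (+ 0) refl }

*-pres-∣ : ∀ {d e a b} → d ∣ a → e ∣ b → d * e ∣ a * b
*-pres-∣ {e = e} {a} d∣a e∣b = ∣-trans (*-monoˡ-∣ e d∣a) (*-monoʳ-∣ a e∣b)

∣m-n∣n⇒∣m : ∀ {d m n} → d ∣ m - n → d ∣ n → d ∣ m
∣m-n∣n⇒∣m d∣m-n d∣n = ∣m+n∣n⇒∣m d∣m-n (∣m⇒∣-m d∣n)

interior-∣ : InR[ t ] u → InR[ t ] v → ∀ k → t * t ∣ interior u v k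
interior-∣ u∈ v∈ zero    = divides (+ 0) refl
interior-∣ u∈ v∈ (suc m) = sumTo-∣ m _ (λ i _ → *-pres-∣ (∣coeff u∈ i) (∣coeff v∈ (m ℕ.∸ i)))

⊛-suc-mod-t² : InR[ t ] u → InR[ t ] v → ∀ k → t * t ∣ (u ⊛ v) (suc k) - (u (suc k) + v (suc k))
⊛-suc-mod-t² {t} {u} {v} u∈ v∈ k = subst (t * t ∣_) (sym excess) (interior-∣ u∈ v∈ k)
  where
  cancel : ∀ a b c → b + c + a - (a + b) ≡ c
  cancel = solve-∀
  excess : (u ⊛ v) (suc k) - (u (suc k) + v (suc k)) ≡ interior u v k
  excess = trans (cong (_- (u (suc k) + v (suc k))) (⊛-suc-InR u v (∈R u∈) (∈R v∈) k))
                 (cancel (u (suc k)) (v (suc k)) (interior u v k))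

InR[]-⊛ : InR[ t ] u → InR[ t ] v → InR[ t ] (u ⊛ v)
InR[]-⊛ {t} {u} {v} u∈ v∈ = record
  { ∈R     = InR-⊛ u v (∈R u∈) (∈R v∈)
  ; ∣coeff = λ k → ∣m-n∣n⇒∣m (∣-trans (∣m⇒∣m*n t ∣-refl) (⊛-suc-mod-t² u∈ v∈ k))
                             (∣m∣n⇒∣m+n (∣coeff u∈ k) (∣coeff v∈ k))
  }

InR[]-^ˢ : ∀ n → InR[ t ] u → InR[ t ] (u ^ˢ n)
InR[]-^ˢ zero    u∈ = InR[]-one
InR[]-^ˢ (suc n) u∈ = InR[]-⊛ u∈ (InR[]-^ˢ n u∈)

^ˢ-suc-mod-t² : InR[ t ] u → ∀ d k → t * t ∣ (u ^ˢ d) (suc k) - + d * u (suc k)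
^ˢ-suc-mod-t²         u∈ zero    k = divides (+ 0) refl
^ˢ-suc-mod-t² {t} {u} u∈ (suc d) k =
  subst (t * t ∣_) (regroup ((u ⊛ (u ^ˢ d)) (suc k)) ((u ^ˢ d) (suc k)) (u (suc k)) (+ d))
    (∣m∣n⇒∣m+n (⊛-suc-mod-t² u∈ (InR[]-^ˢ d u∈) k) (^ˢ-suc-mod-t² u∈ d k))
  where
  regroup : ∀ p q a n → p - (a + q) + (q - n * a) ≡ p - (+ 1 + n) * a
  regroup = solve-∀

InR[]-^ˢ-lift : ∀ d → + d ∣ t → InR[ t ] u → InR[ + d * t ] (u ^ˢ d)
InR[]-^ˢ-lift {t} {u} d d∣t u∈ = record
  { ∈R     = InR-^ˢ u d (∈R u∈)
  ; ∣coeff = λ k → ∣m-n∣n⇒∣m (∣-trans (*-monoˡ-∣ t d∣t) (^ˢ-suc-mod-t² u∈ d k))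
                             (*-monoʳ-∣ (+ d) (∣coeff u∈ k))
  }

InR[]-^ˢ-product : ∀ ps → (∀ {p} → p ∈ ps → + p ∣ t) → InR[ t ] u →
  InR[ + product ps * t ] (u ^ˢ product ps)
InR[]-^ˢ-product {t} {u} [] _ u∈ =
  subst (λ s → InR[ s ] (u ^ˢ 1)) (sym (ℤₚ.*-identityˡ t))
    (InR[]-resp-≈ˢ (λ k → sym (⊛-identityʳ u k)) u∈)
InR[]-^ˢ-product {t} {u} (p ∷ ps) ps∣t u∈ =
  subst (λ s → InR[ s ] (u ^ˢ (p ℕ.* product ps))) (reassoc (product ps) p t)
    (InR[]-resp-≈ˢ (^ˢ-*-assoc u p (product ps))
      (InR[]-^ˢ-product ps (λ q∈ps → ∣n⇒∣m*n (+ p) (ps∣t (there q∈ps)))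
        (InR[]-^ˢ-lift p (ps∣t (here refl)) u∈)))
  where
  reassoc : ∀ m p t → + m * (+ p * t) ≡ + (p ℕ.* m) * t
  reassoc m p t = trans (sym (ℤₚ.*-assoc (+ m) (+ p) t))
                        (cong (_* t) (trans (ℤₚ.*-comm (+ m) (+ p)) (sym (ℤₚ.pos-* p m))))

rad : ℕ → ℕ
rad n = product (primeDivisors n)

prime∣⇒∣rad : ∀ {p n} → .{{NonZero n}} → Prime p → p ℕD.∣ n → p ℕD.∣ rad n
prime∣⇒∣rad {p} {n} p-prime p∣n = ∈⇒∣product
  (∈-filter⁺ (λ q → prime? q ×-dec (q ℕD.∣? n)) (∈-upTo⁺ (s≤s (ℕD.∣⇒≤ p∣n))) (p-prime , p∣n))

InR[rad]-^ˢ : ∀ {n} → 1 ≤ n → InR[ + rad n ] u → InR[ + μ n ] (u ^ˢ n)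
InR[rad]-^ˢ {u} {n} 1≤n u∈ =
  subst (λ s → InR[ s ] (u ^ˢ n)) (sym (ℤₚ.pos-* n (rad n)))
    (subst (λ m → InR[ + m * + rad n ] (u ^ˢ m)) (sym isFactorisation)
      (InR[]-^ˢ-product factors factor∣rad u∈))
  where
  instance
    n≢0 : NonZero n
    n≢0 = >-nonZero 1≤n
  open PrimeFactorisation (factorise n)
  factor∣n : ∀ {p} → p ∈ factors → p ℕD.∣ n
  factor∣n p∈ = subst (_ ℕD.∣_) (sym isFactorisation) (∈⇒∣product p∈)
  factor∣rad : ∀ {p} → p ∈ factors → + p ∣ + rad n
  factor∣rad p∈ = ∣ᵤ⇒∣ (prime∣⇒∣rad (All.lookup factorsPrime p∈) (factor∣n p∈))

-- Extracting n-th roots degree by degree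

addTerm : Series → ℕ → ℤ → Series
addTerm u k c j with j ≟ k
... | yes _ = u j + c
... | no  _ = u j

addTerm-≡ : ∀ u k c → addTerm u k c k ≡ u k + c
addTerm-≡ u k c with k ≟ k
... | yes _   = refl
... | no  k≢k = contradiction refl k≢k

addTerm-≢ : ∀ u {k} c {j} → ¬ j ≡ k → addTerm u k c j ≡ u j
addTerm-≢ u {k} c {j} j≢k with j ≟ k
... | yes j≡k = contradiction j≡k j≢k
... | no  _   = refl

addTerm-≈[] : ∀ {j k c} → j < k → addTerm u k c ≈[ j ] u
addTerm-≈[] {u} {c = c} j<k i i≤j = addTerm-≢ u c (λ { refl → ℕₚ.<⇒≱ j<k i≤j })

addTerm-∣ : ∀ {d} u k {c} j → d ∣ u j → d ∣ c → d ∣ addTerm u k c j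
addTerm-∣ u k j d∣u d∣c with j ≟ k
... | yes _ = ∣m∣n⇒∣m+n d∣u d∣c
... | no  _ = d∣u

InR[]-addTerm : ∀ {c} u k → t ∣ c → InR[ t ] u → InR[ t ] (addTerm u (suc k) c)
InR[]-addTerm {c = c} u k t∣c u∈ = record
  { ∈R     = trans (addTerm-≢ u {suc k} c (λ ())) (∈R u∈)
  ; ∣coeff = λ j → addTerm-∣ u (suc k) (suc j) (∣coeff u∈ j) t∣c
  }

^ˢ-suc-perturb : ∀ n → InR u → u′ ≈[ k ] u →
  (u′ ^ˢ n) (suc k) ≡ (u ^ˢ n) (suc k) + + n * (u′ (suc k) - u (suc k))
^ˢ-suc-perturb zero    u∈R u′≈u = refl
^ˢ-suc-perturb {u} {u′} {k} (suc n) u∈R u′≈u = begin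
  (u′ ⊛ (u′ ^ˢ n)) (suc k)
    ≡⟨ ⊛-suc-InR u′ (u′ ^ˢ n) u′∈R (InR-^ˢ u′ n u′∈R) k ⟩
  (u′ ^ˢ n) (suc k) + interior u′ (u′ ^ˢ n) k + u′ (suc k)
    ≡⟨ cong₂ (λ a b → a + b + u′ (suc k))
             (^ˢ-suc-perturb n u∈R u′≈u) (interior-cong u′≈u (^ˢ-cong-≈[] n u′≈u)) ⟩
  (u ^ˢ n) (suc k) + + n * (u′ (suc k) - u (suc k)) + interior u (u ^ˢ n) k + u′ (suc k)
    ≡⟨ regroup ((u ^ˢ n) (suc k)) (interior u (u ^ˢ n) k) (u (suc k)) (u′ (suc k)) (+ n) ⟩
  (u ^ˢ n) (suc k) + interior u (u ^ˢ n) k + u (suc k) + (+ 1 + + n) * (u′ (suc k) - u (suc k))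
    ≡⟨ cong (_+ + suc n * (u′ (suc k) - u (suc k))) (sym (⊛-suc-InR u (u ^ˢ n) u∈R (InR-^ˢ u n u∈R) k)) ⟩
  (u ⊛ (u ^ˢ n)) (suc k) + + suc n * (u′ (suc k) - u (suc k)) ∎
  where
  open ≡-Reasoning
  u′∈R : InR u′
  u′∈R = trans (u′≈u 0 z≤n) u∈R
  regroup : ∀ x i a a′ n → x + n * (a′ - a) + i + a′ ≡ x + i + a + (+ 1 + n) * (a′ - a)
  regroup = solve-∀

diagonal : (ℕ → Series) → Series
diagonal p k = p k k

diagonal-≈[] : ∀ {p : ℕ → Series} → (∀ k → p (suc k) ≈[ k ] p k) → ∀ k → diagonal p ≈[ k ] p k
diagonal-≈[] {p} coherent k i i≤k = stable (ℕₚ.≤⇒≤′ i≤k)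
  where
  stable : ∀ {m} → i ≤′ m → p i i ≡ p m i
  stable ≤′-refl            = refl
  stable (≤′-step {m} i≤′m) = trans (stable i≤′m) (sym (coherent m i (ℕₚ.≤′⇒≤ i≤′m)))

module _ {n : ℕ} (1≤n : 1 ≤ n) {T : Series} (T∈ : InR[ + μ n ] T) where

  record Approximation (k : ℕ) : Set where
    field
      root     : Series
      root∈    : InR[ + rad n ] root
      root^n≈T : root ^ˢ n ≈[ k ] T

  open Approximation

  refine : Approximation k → Approximation (suc k)
  refine {k} a = record
    { root     = p′
    ; root∈    = InR[]-addTerm p k (∣n⇒∣m*n w ∣-refl) (root∈ a)
    ; root^n≈T = ≈[]-extend lower-coefficients top-coefficient
    }
    where
    p = root a
    gap : + μ n ∣ T (suc k) - (p ^ˢ n) (suc k)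
    gap = ∣m∣n⇒∣m-n (∣coeff T∈ k) (∣coeff (InR[rad]-^ˢ 1≤n (root∈ a)) k)
    w = _∣_.quotient gap
    p′ = addTerm p (suc k) (w * + rad n)
    lower-coefficients : p′ ^ˢ n ≈[ k ] T
    lower-coefficients j j≤k = trans (^ˢ-cong-≈[] n (addTerm-≈[] ℕₚ.≤-refl) j j≤k) (root^n≈T a j j≤k)
    top-coefficient : (p′ ^ˢ n) (suc k) ≡ T (suc k)
    top-coefficient = begin
      (p′ ^ˢ n) (suc k)
        ≡⟨ ^ˢ-suc-perturb n (∈R (root∈ a)) (addTerm-≈[] ℕₚ.≤-refl) ⟩
      P + + n * (p′ (suc k) - p (suc k))
        ≡⟨ cong (λ x → P + + n * (x - p (suc k))) (addTerm-≡ p (suc k) _) ⟩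
      P + + n * (p (suc k) + w * + rad n - p (suc k))
        ≡⟨ regroup P (p (suc k)) w (+ rad n) (+ n) ⟩
      P + w * (+ n * + rad n)
        ≡⟨ cong (λ m → P + w * m) (sym (ℤₚ.pos-* n (rad n))) ⟩
      P + w * + μ n
        ≡⟨ cong (λ x → P + x) (sym (_∣_.equality gap)) ⟩
      P + (T (suc k) - P)
        ≡⟨ cancel P (T (suc k)) ⟩
      T (suc k) ∎
      where
      open ≡-Reasoning
      P = (p ^ˢ n) (suc k)
      regroup : ∀ P a w r n → P + n * (a + w * r - a) ≡ P + w * (n * r)
      regroup = solve-∀
      cancel : ∀ P t → P + (t - P) ≡ t
      cancel = solve-∀

  approximation : ∀ k → Approximation k
  approximation zero    = record
    { root     = one
    ; root∈    = InR[]-one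
    ; root^n≈T = λ { .0 z≤n → trans (InR-^ˢ one n refl) (sym (∈R T∈)) }
    }
  approximation (suc k) = refine (approximation k)

  root-coherent : ∀ k → root (approximation (suc k)) ≈[ k ] root (approximation k)
  root-coherent k = addTerm-≈[] ℕₚ.≤-refl

  InR[μ]⇒InP : InP n T
  InR[μ]⇒InP = g , refl , λ k →
    trans (^ˢ-cong-≈[] n (diagonal-≈[] root-coherent k) k ℕₚ.≤-refl)
          (root^n≈T (approximation k) k ℕₚ.≤-refl)
    where
    g = diagonal (root ∘ approximation)

InR[]-scale : ∀ A f → InR f → t ∣ A * f 1 → t ∣ A * A → InR[ t ] (scale A f)
InR[]-scale {t} A f f∈R t∣Af₁ t∣AA = record { ∈R = trans (ℤₚ.*-identityʳ (f 0)) f∈R ; ∣coeff = t∣coeff }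
  where
  t∣coeff : ∀ k → t ∣ scale A f (suc k)
  t∣coeff zero    = subst (t ∣_) (swap A (f 1)) t∣Af₁
    where
    swap : ∀ a x → a * x ≡ x * (a * + 1)
    swap = solve-∀
  t∣coeff (suc k) = ∣-trans t∣AA (∣n⇒∣m*n (f (suc (suc k))) (*-monoʳ-∣ A (∣m⇒∣m*n (A ^ k) ∣-refl)))

corollary3 : (n : ℕ) → 1 ℕ.≤ n → (f : Series) → InR f →
    (A B : ℕ) → 1 ℕ.≤ A → 1 ℕ.≤ B →
    (+ μ n) ℤD.∣ (+ A ℤ.* + B) → (+ μ n) ℤD.∣ (+ A ℤ.* + A) →
    (+ B) ℤD.∣ f 1 →
    InP n (scale (+ A) f)
corollary3 n 1≤n f f∈R A B _ _ μ∣AB μ∣AA B∣f₁ =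
  InR[μ]⇒InP 1≤n (InR[]-scale (+ A) f f∈R μ∣Af₁ (∣ᵤ⇒∣ μ∣AA))
  where
  μ∣Af₁ : + μ n ∣ + A * f 1
  μ∣Af₁ = ∣-trans (∣ᵤ⇒∣ μ∣AB) (*-monoʳ-∣ (+ A) (∣ᵤ⇒∣ B∣f₁))
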